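{- Let $p$ be a prime, let $A\subset\mathbb{F}_p$, and let $n\ge1$ be an integer. Then $|8^nA^n-8^nA^n|\ge\frac18\min(|A|^n,p)$.
   Context: $\mathbb{F}_p$ is the field with $p$ elements. $A^n=\{a_1\cdots a_n : a_i\in A\}$; for a set $X$ and integer $k\ge1$, $kX=\{x_1+\dots+x_k : x_i\in X\}$; $X-Y=\{x-y:x\in X,y\in Y\}$. -}

module Defs where

open import Data.Bool using (Bool; true; false; _∧_; _∨_)
open import Data.Nat using (ℕ; zero; suc; _+_; _*_; _∸_; _%_; NonZero)
open import Data.Nat.DivMod using (m%n<n)
open import Data.Fin using (Fin; toℕ; fromℕ<)
open import Data.Fin.Subset using (Subset; ⁅_⁆)
open import Data.Fin.Properties using (_≟_)
open import Data.List using (List; allFin)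
open import Data.Bool.ListAction using (any)
open import Data.Vec using (lookup; tabulate)
open import Relation.Nullary.Decidable using (⌊_⌋)

-- Elements of 𝔽_p are represented by Fin p (residues 0 … p-1).
module _ {p : ℕ} .{{_ : NonZero p}} where

  toF : ℕ → Fin p
  toF m = fromℕ< (m%n<n m p)

  _+F_ _*F_ _-F_ : Fin p → Fin p → Fin p
  x +F y = toF (toℕ x + toℕ y)
  x *F y = toF (toℕ x * toℕ y)
  x -F y = toF (toℕ x + (p ∸ toℕ y))

  image₂ : (Fin p → Fin p → Fin p) → Subset p → Subset p → Subset p
  image₂ f X Y = tabulate λ z →
    any (λ x → any (λ y → lookup X x ∧ lookup Y y ∧ ⌊ f x y ≟ z ⌋) (allFin p)) (allFin p)

  _⊕_ _⊖_ _⊗_ : Subset p → Subset p → Subset p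
  X ⊕ Y = image₂ _+F_ X Y
  X ⊖ Y = image₂ _-F_ X Y
  X ⊗ Y = image₂ _*F_ X Y

  -- A^n = { a₁ ⋯ aₙ : aᵢ ∈ A }   (A^0 = {1}, only used for n ≥ 1)
  prodPow : ℕ → Subset p → Subset p
  prodPow zero    A = ⁅ toF 1 ⁆
  prodPow (suc n) A = prodPow n A ⊗ A

  -- k X = { x₁ + ⋯ + x_k : xᵢ ∈ X }   (0 X = {0}, only used for k ≥ 1)
  sumPow : ℕ → Subset p → Subset p
  sumPow zero    X = ⁅ toF 0 ⁆
  sumPow (suc k) X = sumPow k X ⊕ X

module Submission where

-- Let Sₖ = 8ᵏAᵏ - 8ᵏAᵏ and m = |A| ≥ 2 (smaller A are trivial). Expanding products shows that
-- S_{k+1} contains d x + (x₁ - x₂) a and d x + (x₁ - x₂) a + y d a for x, x₁, x₂ ∈ Sₖ, a ∈ A,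
-- d = a₁ - a₂ with a₁, a₂ ∈ A, and y ∈ A^{k-1} (Growth). Key step: on the grid Sₖ × A consider the
-- lines (x , a) ↦ x + ξ a. Two grid points collide for at most one slope ξ, so some ξ has at most
-- N²/2p collisions on N = min(|Sₖ| m, p) grid points. If ξ is a ratio (x₂ - x₁)/(a₁ - a₂), the first
-- family gives |S_{k+1}| ≥ N - N²/2p; otherwise stepping by y ≠ 0 from the ratio 0 leads to a ratio q
-- with q + y not a ratio, and the second family embeds Sₖ × A into S_{k+1} (KeyStep). Either way
-- |S_{k+1}| ≥ p |Sₖ| m / (p + 2 |Sₖ| m); from |S₁| ≥ m, induction gives |Sₖ| ≥ p mᵏ / (p + 4 mᵏ),
-- which is at least min(mᵏ, p) / 5 (Arithmetic).

open import Defs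
open import Data.Nat using (ℕ; suc; _^_; _≤_; _⊓_; NonZero)
open import Data.Nat.Primality using (Prime)
open import Data.Fin.Subset using (Subset; ∣_∣)

module ResidueRing where
  open import Data.Nat as ℕ using (_+_; _*_; _∸_; _%_)
  import Data.Nat.Properties as ℕₚ
  open import Data.Nat.DivMod using (m%n<n; %-distribˡ-+; %-distribˡ-*; n%n≡0; m<n⇒m%n≡m)
  open import Data.Fin using (Fin; toℕ)
  open import Data.Fin.Properties using (toℕ-fromℕ<; toℕ-injective; toℕ<n)
  open import Data.Product using (_,_)
  open import Algebra.Bundles using (CommutativeRing)
  open import Relation.Binary.PropositionalEquality

  -- Reduction toF : ℕ → Fin p is a surjective semiring homomorphism (toF-+, toF-*, toF-toℕ);
  -- the commutative ring laws of the residues are transported from those of ℕ along it.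
  module _ {p : ℕ} .{{_ : NonZero p}} where

    toℕ-toF : ∀ m → toℕ (toF {p} m) ≡ m % p
    toℕ-toF m = toℕ-fromℕ< (m%n<n m p)

    toF-toℕ : ∀ (x : Fin p) → toF (toℕ x) ≡ x
    toF-toℕ x = toℕ-injective (trans (toℕ-toF (toℕ x)) (m<n⇒m%n≡m (toℕ<n x)))

    toF-cong : ∀ {m n} → m % p ≡ n % p → toF {p} m ≡ toF n
    toF-cong e = toℕ-injective (trans (toℕ-toF _) (trans e (sym (toℕ-toF _))))

    toF-+ : ∀ m n → toF {p} (m + n) ≡ toF m +F toF n
    toF-+ m n = toF-cong (begin
      (m + n) % p                               ≡⟨ %-distribˡ-+ m n p ⟩
      (m % p + n % p) % p                       ≡⟨ cong₂ (λ a b → (a + b) % p) (toℕ-toF m) (toℕ-toF n) ⟨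
      (toℕ (toF {p} m) + toℕ (toF {p} n)) % p   ∎)
      where open ≡-Reasoning

    toF-* : ∀ m n → toF {p} (m * n) ≡ toF m *F toF n
    toF-* m n = toF-cong (begin
      (m * n) % p                               ≡⟨ %-distribˡ-* m n p ⟩
      (m % p * (n % p)) % p                     ≡⟨ cong₂ (λ a b → (a * b) % p) (toℕ-toF m) (toℕ-toF n) ⟨
      (toℕ (toF {p} m) * toℕ (toF {p} n)) % p   ∎)
      where open ≡-Reasoning

    absorbˡ-+ : ∀ m n → toF {p} (toℕ (toF {p} m) + n) ≡ toF (m + n)
    absorbˡ-+ m n = trans (toF-+ _ n) (trans (cong (_+F toF n) (toF-toℕ (toF m))) (sym (toF-+ m n)))

    absorbʳ-+ : ∀ m n → toF {p} (m + toℕ (toF {p} n)) ≡ toF (m + n)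
    absorbʳ-+ m n = trans (toF-+ m _) (trans (cong (toF m +F_) (toF-toℕ (toF n))) (sym (toF-+ m n)))

    absorbˡ-* : ∀ m n → toF {p} (toℕ (toF {p} m) * n) ≡ toF (m * n)
    absorbˡ-* m n = trans (toF-* _ n) (trans (cong (_*F toF n) (toF-toℕ (toF m))) (sym (toF-* m n)))

    absorbʳ-* : ∀ m n → toF {p} (m * toℕ (toF {p} n)) ≡ toF (m * n)
    absorbʳ-* m n = trans (toF-* m _) (trans (cong (toF m *F_) (toF-toℕ (toF n))) (sym (toF-* m n)))

    negF : Fin p → Fin p
    negF x = toF (p ∸ toℕ x)

    +F-assoc : ∀ x y z → (x +F y) +F z ≡ x +F (y +F z)
    +F-assoc x y z = begin
      toF (toℕ (toF (toℕ x + toℕ y)) + toℕ z)  ≡⟨ absorbˡ-+ _ _ ⟩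
      toF ((toℕ x + toℕ y) + toℕ z)            ≡⟨ cong toF (ℕₚ.+-assoc (toℕ x) _ _) ⟩
      toF (toℕ x + (toℕ y + toℕ z))            ≡⟨ absorbʳ-+ _ _ ⟨
      toF (toℕ x + toℕ (toF (toℕ y + toℕ z)))  ∎
      where open ≡-Reasoning

    *F-assoc : ∀ x y z → (x *F y) *F z ≡ x *F (y *F z)
    *F-assoc x y z = begin
      toF (toℕ (toF (toℕ x * toℕ y)) * toℕ z)  ≡⟨ absorbˡ-* (toℕ x * toℕ y) (toℕ z) ⟩
      toF ((toℕ x * toℕ y) * toℕ z)            ≡⟨ cong toF (ℕₚ.*-assoc (toℕ x) _ _) ⟩
      toF (toℕ x * (toℕ y * toℕ z))            ≡⟨ absorbʳ-* (toℕ x) (toℕ y * toℕ z) ⟨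
      toF (toℕ x * toℕ (toF (toℕ y * toℕ z)))  ∎
      where open ≡-Reasoning

    +F-comm : ∀ x y → x +F y ≡ y +F x
    +F-comm x y = cong toF (ℕₚ.+-comm (toℕ x) (toℕ y))

    *F-comm : ∀ x y → x *F y ≡ y *F x
    *F-comm x y = cong toF (ℕₚ.*-comm (toℕ x) (toℕ y))

    +F-identityˡ : ∀ x → toF 0 +F x ≡ x
    +F-identityˡ x = trans (absorbˡ-+ 0 (toℕ x)) (toF-toℕ x)

    *F-identityˡ : ∀ x → toF 1 *F x ≡ x
    *F-identityˡ x = trans (absorbˡ-* 1 (toℕ x)) (trans (cong toF (ℕₚ.*-identityˡ (toℕ x))) (toF-toℕ x))

    *F-distribʳ : ∀ x y z → (y +F z) *F x ≡ (y *F x) +F (z *F x)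
    *F-distribʳ x y z = begin
      toF (toℕ (toF (toℕ y + toℕ z)) * toℕ x)            ≡⟨ absorbˡ-* (toℕ y + toℕ z) (toℕ x) ⟩
      toF ((toℕ y + toℕ z) * toℕ x)                      ≡⟨ cong toF (ℕₚ.*-distribʳ-+ (toℕ x) (toℕ y) _) ⟩
      toF (toℕ y * toℕ x + toℕ z * toℕ x)                ≡⟨ absorbˡ-+ (toℕ y * toℕ x) (toℕ z * toℕ x) ⟨
      toF (toℕ (toF (toℕ y * toℕ x)) + toℕ z * toℕ x)    ≡⟨ absorbʳ-+ (toℕ (y *F x)) (toℕ z * toℕ x) ⟨
      (y *F x) +F (z *F x)                               ∎
      where open ≡-Reasoning

    +F-inverseʳ : ∀ x → x +F negF x ≡ toF 0
    +F-inverseʳ x = begin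
      toF (toℕ x + toℕ (toF (p ∸ toℕ x)))  ≡⟨ absorbʳ-+ _ _ ⟩
      toF (toℕ x + (p ∸ toℕ x))            ≡⟨ cong toF (ℕₚ.m+[n∸m]≡n (ℕₚ.<⇒≤ (toℕ<n x))) ⟩
      toF p                                ≡⟨ toF-cong (trans (n%n≡0 p) (sym (m<n⇒m%n≡m (ℕ.>-nonZero⁻¹ p)))) ⟩
      toF 0                                ∎
      where open ≡-Reasoning

    -F≡+negF : ∀ x y → x -F y ≡ x +F negF y
    -F≡+negF x y = sym (absorbʳ-+ (toℕ x) (p ∸ toℕ y))

    𝔽 : CommutativeRing _ _
    𝔽 = record
      { Carrier = Fin p ; _≈_ = _≡_ ; _+_ = _+F_ ; _*_ = _*F_ ; -_ = negF ; 0# = toF 0 ; 1# = toF 1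
      ; isCommutativeRing = record
        { isRing = record
          { +-isAbelianGroup = record
            { isGroup = record
              { isMonoid = record
                { isSemigroup = record
                  { isMagma = record { isEquivalence = isEquivalence ; ∙-cong = cong₂ _+F_ }
                  ; assoc = +F-assoc }
                ; identity = +F-identityˡ , λ x → trans (+F-comm x _) (+F-identityˡ x) }
              ; inverse = (λ x → trans (+F-comm (negF x) x) (+F-inverseʳ x)) , +F-inverseʳ
              ; ⁻¹-cong = cong negF }
            ; comm = +F-comm }
          ; *-cong = cong₂ _*F_
          ; *-assoc = *F-assoc
          ; *-identity = *F-identityˡ , λ x → trans (*F-comm x _) (*F-identityˡ x)
          ; distrib = (λ x y z → trans (*F-comm x _) (trans (*F-distribʳ x y z) (cong₂ _+F_ (*F-comm y x) (*F-comm z x))))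
                    , *F-distribʳ }
        ; *-comm = *F-comm } }

module PrimeField where
  open import Data.Nat as ℕ using (zero)
  import Data.Nat.Properties as ℕₚ
  open import Data.Nat.DivMod using (m<n⇒m%n≡m)
  open import Data.Nat.Divisibility using (_∣_; ∣⇒≤; m%n≡0⇒n∣m)
  open import Data.Nat.Primality using (Prime; prime⇒nonTrivial; euclidsLemma)
  open import Data.Fin using (Fin; toℕ; punchOut)
  open import Data.Fin.Properties using (_≟_; toℕ-injective; toℕ<n; any?; injective⇒≤; punchOut-injective)
  open import Data.Product using (∃; _,_)
  open import Data.Sum using (_⊎_; inj₁; inj₂; map)
  open import Algebra.Bundles using (CommutativeRing)
  open import Relation.Nullary using (yes; no; contradiction)
  open import Relation.Binary.PropositionalEquality
  open ResidueRing

  injective⇒surjective : ∀ {n} (f : Fin n → Fin n) → (∀ {i j} → f i ≡ f j → i ≡ j) →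
                         ∀ z → ∃ λ i → f i ≡ z
  injective⇒surjective {zero}  f inj ()
  injective⇒surjective {suc n} f inj z with any? (λ i → f i ≟ z)
  ... | yes hit = hit
  ... | no miss = contradiction (injective⇒≤ {f = avoid} avoid-injective) ℕₚ.1+n≰n
    where
    -- f misses z, so it factors through Fin n
    avoid : Fin (suc n) → Fin n
    avoid i = punchOut {i = z} {j = f i} (λ z≡fi → miss (i , sym z≡fi))
    avoid-injective : ∀ {i j} → avoid i ≡ avoid j → i ≡ j
    avoid-injective {i} {j} e = inj (punchOut-injective (λ z≡fi → miss (i , sym z≡fi)) (λ z≡fj → miss (j , sym z≡fj)) e)

  module _ {p : ℕ} .{{_ : NonZero p}} where
    open CommutativeRing (𝔽 {p}) using (_+_; _*_; _-_; 0#; 1#; ring; *-comm; +-comm; zeroˡ; *-identityˡ; distribʳ)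
    open import Algebra.Properties.Ring ring using (x∙y⁻¹≈ε⇒x≈y; x≈y⇒x∙y⁻¹≈ε; x[y-z]≈xy-xz)

    toℕ-small : ∀ {m} → m ℕ.< p → toℕ (toF {p} m) ≡ m
    toℕ-small m<p = trans (toℕ-toF _) (m<n⇒m%n≡m m<p)

    p∣⇒≡0# : ∀ x → p ∣ toℕ x → x ≡ 0#
    p∣⇒≡0# x p∣x with toℕ x in eq
    ... | zero  = toℕ-injective (trans eq (sym (toℕ-small (ℕ.>-nonZero⁻¹ p))))
    ... | suc _ = contradiction (∣⇒≤ p∣x) (ℕₚ.<⇒≱ (subst (ℕ._< p) eq (toℕ<n x)))

    module _ (p-prime : Prime p) where

      1#≢0# : 1# ≢ 0#
      1#≢0# 1≡0 = ℕₚ.1+n≢0 (begin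
        1            ≡⟨ toℕ-small 1<p ⟨
        toℕ 1#       ≡⟨ cong toℕ 1≡0 ⟩
        toℕ 0#       ≡⟨ toℕ-small (ℕ.>-nonZero⁻¹ p) ⟩
        0            ∎)
        where
        open ≡-Reasoning
        1<p : 1 ℕ.< p
        1<p = ℕ.nonTrivial⇒n>1 p {{prime⇒nonTrivial p-prime}}

      noZeroDivisors : ∀ x y → x * y ≡ 0# → x ≡ 0# ⊎ y ≡ 0#
      noZeroDivisors x y xy≡0 = map (p∣⇒≡0# x) (p∣⇒≡0# y) (euclidsLemma (toℕ x) (toℕ y) p-prime p∣xy)
        where
        p∣xy : p ∣ toℕ x ℕ.* toℕ y
        p∣xy = m%n≡0⇒n∣m _ p (trans (sym (toℕ-toF _)) (trans (cong toℕ xy≡0) (toℕ-small (ℕ.>-nonZero⁻¹ p))))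

      *-cancelˡ : ∀ {d x y} → d ≢ 0# → d * x ≡ d * y → x ≡ y
      *-cancelˡ {d} {x} {y} d≢0 dx≡dy with noZeroDivisors d (x - y) (trans (x[y-z]≈xy-xz d x y) (x≈y⇒x∙y⁻¹≈ε dx≡dy))
      ... | inj₁ d≡0   = contradiction d≡0 d≢0
      ... | inj₂ x-y≡0 = x∙y⁻¹≈ε⇒x≈y x y x-y≡0

      *-cancelʳ : ∀ {d x y} → d ≢ 0# → x * d ≡ y * d → x ≡ y
      *-cancelʳ {d} {x} {y} d≢0 xd≡yd = *-cancelˡ d≢0 (trans (*-comm d x) (trans xd≡yd (*-comm y d)))

      -- a property of 0 that is preserved by adding y ≠ 0 holds everywhere,
      -- since every element is a multiple of y
      additive-orbit : ∀ {ℓ} {P : Fin p → Set ℓ} {y} → y ≢ 0# → P 0# → (∀ q → P q → P (q + y)) → ∀ z → P z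
      additive-orbit {P = P} {y} y≢0 P0 step z with injective⇒surjective (_* y) (*-cancelʳ y≢0) z
      ... | x , xy≡z = subst P (trans (cong (_* y) (toF-toℕ x)) xy≡z) (multiples (toℕ x))
        where
        multiples : ∀ k → P (toF k * y)
        multiples zero    = subst P (sym (zeroˡ y)) P0
        multiples (suc k) = subst P (begin
          toF k * y + y           ≡⟨ +-comm _ y ⟩
          y + toF k * y           ≡⟨ cong (_+ toF k * y) (*-identityˡ y) ⟨
          1# * y + toF k * y      ≡⟨ distribʳ y 1# (toF k) ⟨
          (1# + toF k) * y        ≡⟨ cong (_* y) (toF-+ 1 k) ⟨
          toF (suc k) * y         ∎) (step _ (multiples k))
          where open ≡-Reasoning

module Sumsets where
  open import Data.Nat as ℕ using (zero)
  import Data.Nat.Properties as ℕₚ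
  open import Data.Bool using (T; _∧_)
  open import Data.Bool.Properties using (T-≡; T-∧)
  open import Data.List using (allFin)
  open import Data.List.Relation.Unary.Any.Properties using (any⁺; any⁻)
  open import Data.List.Membership.Propositional using (lose; find)
  open import Data.List.Membership.Propositional.Properties using (∈-allFin)
  open import Data.Fin using (Fin)
  open import Data.Fin.Properties using (_≟_)
  open import Data.Fin.Subset using (Subset; _∈_)
  open import Data.Fin.Subset.Properties using (x∈⁅x⁆; x∈⁅y⁆⇒x≡y)
  open import Data.Vec using (lookup)
  open import Data.Vec.Properties using (lookup∘tabulate; []=⇒lookup; lookup⇒[]=)
  open import Data.Product using (∃; ∃₂; _×_; _,_)
  open import Function.Bundles using (Equivalence)
  open import Relation.Nullary.Decidable using (toWitness; fromWitness)
  open import Algebra.Bundles using (CommutativeRing)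
  open import Relation.Binary.PropositionalEquality
  open ResidueRing

  module _ {p : ℕ} .{{_ : NonZero p}} where
    open CommutativeRing (𝔽 {p})
      using (_+_; _*_; _-_; 0#; 1#; ring; +-assoc; +-identityˡ; +-identityʳ; *-identityˡ; zeroˡ; distribʳ)
    open import Algebra.Properties.Ring ring using (//-rightDividesˡ; //-rightDividesʳ)

    ∈⇒T : ∀ {S : Subset p} {x} → x ∈ S → T (lookup S x)
    ∈⇒T x∈S = Equivalence.from T-≡ ([]=⇒lookup x∈S)

    T⇒∈ : ∀ {S : Subset p} {x} → T (lookup S x) → x ∈ S
    T⇒∈ {S} {x} t = lookup⇒[]= x S (Equivalence.to T-≡ t)

    image₂⁺ : ∀ f {X Y : Subset p} {x y} → x ∈ X → y ∈ Y → f x y ∈ image₂ f X Y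
    image₂⁺ f {X} {Y} {x} {y} x∈X y∈Y = T⇒∈ (subst T (sym (lookup∘tabulate _ (f x y)))
      (any⁺ _ (lose (∈-allFin x) (any⁺ _ (lose (∈-allFin y) witness)))))
      where
      witness : T (lookup X x ∧ lookup Y y ∧ Relation.Nullary.Decidable.⌊ f x y ≟ f x y ⌋)
      witness = Equivalence.from T-∧ (∈⇒T x∈X , Equivalence.from T-∧ (∈⇒T y∈Y , fromWitness refl))

    image₂⁻ : ∀ f (X Y : Subset p) {z} → z ∈ image₂ f X Y → ∃₂ λ x y → x ∈ X × y ∈ Y × f x y ≡ z
    image₂⁻ f X Y {z} z∈ with find (any⁻ _ (allFin p) (subst T (lookup∘tabulate _ z) (∈⇒T z∈)))
    ... | x , _ , tx with find (any⁻ _ (allFin p) tx)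
    ... | y , _ , txyz with Equivalence.to T-∧ txyz
    ... | tX , tyz with Equivalence.to T-∧ tyz
    ... | tY , tz = x , y , T⇒∈ tX , T⇒∈ tY , toWitness tz

    module _ {X : Subset p} where

      sumPow-zero⁻ : ∀ {z} → z ∈ sumPow 0 X → z ≡ 0#
      sumPow-zero⁻ = x∈⁅y⁆⇒x≡y 0#

      sumPow-one⁺ : ∀ {x} → x ∈ X → x ∈ sumPow 1 X
      sumPow-one⁺ {x} x∈X = subst (_∈ sumPow 1 X) (+-identityˡ x) (image₂⁺ _+F_ (x∈⁅x⁆ 0#) x∈X)

      sumPow-+ : ∀ j k {u v} → u ∈ sumPow j X → v ∈ sumPow k X → u + v ∈ sumPow (j ℕ.+ k) X
      sumPow-+ j zero {u} u∈ v∈ rewrite sumPow-zero⁻ v∈ | ℕₚ.+-identityʳ j =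
        subst (_∈ sumPow j X) (sym (+-identityʳ u)) u∈
      sumPow-+ j (suc k) {u} u∈ v∈ with image₂⁻ _+F_ (sumPow k X) X v∈
      ... | v′ , x , v′∈ , x∈ , refl rewrite ℕₚ.+-suc j k =
        subst (_∈ sumPow (suc (j ℕ.+ k)) X) (+-assoc u v′ x) (image₂⁺ _+F_ (sumPow-+ j k u∈ v′∈) x∈)

      sumPow-nonempty : ∀ {c} → c ∈ X → ∀ k → ∃ λ u → u ∈ sumPow k X
      sumPow-nonempty c∈X zero    = 0# , x∈⁅x⁆ 0#
      sumPow-nonempty c∈X (suc k) with sumPow-nonempty c∈X k
      ... | u , u∈ = u + _ , image₂⁺ _+F_ u∈ c∈X

      sumPow-scale : ∀ {Y : Subset p} {a} → (∀ {x} → x ∈ X → x * a ∈ Y) →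
                     ∀ k {u} → u ∈ sumPow k X → u * a ∈ sumPow k Y
      sumPow-scale {Y} {a} Xa⊆Y zero u∈ rewrite sumPow-zero⁻ u∈ = subst (_∈ sumPow 0 Y) (sym (zeroˡ a)) (x∈⁅x⁆ 0#)
      sumPow-scale {Y} {a} Xa⊆Y (suc k) u∈ with image₂⁻ _+F_ (sumPow k X) X u∈
      ... | u′ , x , u′∈ , x∈ , refl =
        subst (_∈ sumPow (suc k) Y) (sym (distribʳ a u′ x)) (image₂⁺ _+F_ (sumPow-scale Xa⊆Y k u′∈) (Xa⊆Y x∈))

    -- the difference set Y ⊖ Y consists exactly of the u - v with u, v ∈ Y
    -- (the converse is stated additively: z = u - v as z + v = u)
    ∈⊖⁺ : ∀ {Y : Subset p} {u v} → u ∈ Y → v ∈ Y → u - v ∈ Y ⊖ Y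
    ∈⊖⁺ {Y} {u} {v} u∈ v∈ = subst (_∈ Y ⊖ Y) (-F≡+negF u v) (image₂⁺ _-F_ u∈ v∈)

    ∈⊖⁻ : ∀ {Y : Subset p} {z} → z ∈ Y ⊖ Y → ∃₂ λ u v → u ∈ Y × v ∈ Y × z + v ≡ u
    ∈⊖⁻ {Y} z∈ with image₂⁻ _-F_ Y Y z∈
    ... | u , v , u∈ , v∈ , refl = u , v , u∈ , v∈ , trans (cong (_+ v) (-F≡+negF u v)) (//-rightDividesˡ v u)

    -- if z + v = u with u, v ∈ r X, then z ∈ N X ⊖ N X for every N ≥ r
    -- (add the same element of (N - r) X to u and v; this needs X ≠ ∅)
    ∈⊖-padded : ∀ {X : Subset p} {c r N u v z} → c ∈ X → r ℕ.≤ N →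
                u ∈ sumPow r X → v ∈ sumPow r X → z + v ≡ u → z ∈ sumPow N X ⊖ sumPow N X
    ∈⊖-padded {X} {c} {r} {N} {u} {v} {z} c∈X r≤N u∈ v∈ z+v≡u with sumPow-nonempty c∈X (N ℕ.∸ r)
    ... | w , w∈ = subst (_∈ sumPow N X ⊖ sumPow N X) difference (∈⊖⁺ (pad u∈) (pad v∈))
      where
      pad : ∀ {t} → t ∈ sumPow r X → t + w ∈ sumPow N X
      pad t∈ = subst (λ n → _ ∈ sumPow n X) (ℕₚ.m+[n∸m]≡n r≤N) (sumPow-+ r (N ℕ.∸ r) t∈ w∈)
      difference : (u + w) - (v + w) ≡ z
      difference = begin
        (u + w) - (v + w)        ≡⟨ cong (λ t → (t + w) - (v + w)) z+v≡u ⟨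
        ((z + v) + w) - (v + w)  ≡⟨ cong (_- (v + w)) (+-assoc z v w) ⟩
        (z + (v + w)) - (v + w)  ≡⟨ //-rightDividesʳ (v + w) z ⟩
        z                        ∎
        where open ≡-Reasoning

    module _ {A : Subset p} where

      prodPow-one⁺ : ∀ {a} → a ∈ A → a ∈ prodPow 1 A
      prodPow-one⁺ {a} a∈A = subst (_∈ prodPow 1 A) (*-identityˡ a) (image₂⁺ _*F_ (x∈⁅x⁆ 1#) a∈A)

      prodPow-witness : ∀ {ℓ} (Q : Fin p → Set ℓ) {c} → c ∈ A → Q 1# → (∀ {y} → Q y → Q (y * c)) →
                        ∀ k → ∃ λ y → y ∈ prodPow k A × Q y
      prodPow-witness Q c∈A Q1 Q-step zero    = 1# , x∈⁅x⁆ 1# , Q1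
      prodPow-witness Q c∈A Q1 Q-step (suc k) with prodPow-witness Q c∈A Q1 Q-step k
      ... | y , y∈ , Qy = _ , image₂⁺ _*F_ y∈ c∈A , Q-step Qy

module Counting where
  open import Data.Bool using (true; false)
  open import Data.Nat as ℕ using (zero; _+_; _*_; z≤n; s≤s)
  import Data.Nat.Properties as ℕₚ
  open import Data.Fin using (Fin)
  open import Data.Fin.Properties using (_≟_; suc-injective)
  open import Data.Fin.Subset using (Subset; _∈_; ∣_∣; _-_)
  open import Data.Fin.Subset.Properties using (x∈p∧x≢y⇒x∈p-y; x∈p⇒∣p-x∣<∣p∣)
  open import Data.Vec using (_∷_; []; here; there)
  open import Data.List using (List; []; _∷_; length; map; cartesianProduct)
  open import Data.List.Properties using (length-map; length-++)
  open import Data.List.Membership.Propositional using () renaming (_∈_ to _∈ₗ_)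
  open import Data.List.Membership.Propositional.Properties using (∈-map⁻; ∈-cartesianProduct⁻)
  open import Data.List.Relation.Unary.All as All using (All; []; _∷_)
  open import Data.List.Relation.Unary.All.Properties using (map⁺; ¬Any⇒All¬)
  open import Data.List.Relation.Unary.Any as Any using (Any; here; there; any?)
  open import Data.List.Relation.Unary.AllPairs using ([]; _∷_)
  open import Data.List.Relation.Unary.Unique.Propositional using (Unique)
  import Data.List.Relation.Unary.Unique.Propositional.Properties as Unique
  open import Data.Product using (∃; _×_; _,_)
  open import Data.Sum using (inj₁; inj₂)
  open import Algebra.Properties.CommutativeSemigroup ℕₚ.+-commutativeSemigroup using (interchange)
  open import Relation.Nullary using (Dec; yes; no; contradiction)
  open import Relation.Binary.PropositionalEquality
  open import Data.Nat.Tactic.RingSolver using (solve-∀)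

  members : ∀ {n} → Subset n → List (Fin n)
  members []          = []
  members (true  ∷ S) = Fin.zero ∷ map Fin.suc (members S)
  members (false ∷ S) = map Fin.suc (members S)

  length-members : ∀ {n} (S : Subset n) → length (members S) ≡ ∣ S ∣
  length-members []          = refl
  length-members (true  ∷ S) = cong suc (trans (length-map Fin.suc (members S)) (length-members S))
  length-members (false ∷ S) = trans (length-map Fin.suc (members S)) (length-members S)

  members-∈ : ∀ {n} (S : Subset n) → All (_∈ S) (members S)
  members-∈ []          = []
  members-∈ (true  ∷ S) = here ∷ map⁺ (All.map there (members-∈ S))
  members-∈ (false ∷ S) = map⁺ (All.map there (members-∈ S))

  members-unique : ∀ {n} (S : Subset n) → Unique (members S)
  members-unique []          = []
  members-unique (true  ∷ S) = All.tabulate zero∉ ∷ Unique.map⁺ suc-injective (members-unique S)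
    where
    zero∉ : ∀ {i} → i ∈ₗ map Fin.suc (members S) → Fin.zero ≢ i
    zero∉ i∈ zero≡i with ∈-map⁻ Fin.suc i∈
    ... | _ , _ , i≡suc with trans zero≡i i≡suc
    ... | ()
  members-unique (false ∷ S) = Unique.map⁺ suc-injective (members-unique S)

  some-member : ∀ {n} (S : Subset n) → 1 ≤ ∣ S ∣ → ∃ λ x → x ∈ S
  some-member S 1≤∣S∣ with members S | length-members S | members-∈ S
  ... | []    | ∣S∣≡0 | _       = contradiction (subst (1 ≤_) (sym ∣S∣≡0) 1≤∣S∣) λ ()
  ... | x ∷ _ | _     | x∈S ∷ _ = x , x∈S

  two-members : ∀ {n} (S : Subset n) → 2 ≤ ∣ S ∣ → ∃ λ x → ∃ λ y → x ∈ S × y ∈ S × x ≢ y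
  two-members S 2≤∣S∣ with members S | length-members S | members-∈ S | members-unique S
  ... | []        | ∣S∣≡0 | _             | _               = contradiction (subst (2 ≤_) (sym ∣S∣≡0) 2≤∣S∣) λ ()
  ... | _ ∷ []    | ∣S∣≡1 | _             | _               = contradiction (subst (2 ≤_) (sym ∣S∣≡1) 2≤∣S∣) λ { (s≤s ()) }
  ... | x ∷ y ∷ _ | _     | x∈S ∷ y∈S ∷ _ | (x≢y ∷ _) ∷ _ = x , y , x∈S , y∈S , x≢y

  memberPairs : ∀ {n m} → Subset n → Subset m → List (Fin n × Fin m)
  memberPairs X A = cartesianProduct (members X) (members A)

  memberPairs-∈ : ∀ {n m} (X : Subset n) (A : Subset m) → All (λ (x , a) → x ∈ X × a ∈ A) (memberPairs X A)
  memberPairs-∈ X A = All.tabulate λ xa∈ → let x∈ , a∈ = ∈-cartesianProduct⁻ (members X) (members A) xa∈ in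
    All.lookup (members-∈ X) x∈ , All.lookup (members-∈ A) a∈

  memberPairs-unique : ∀ {n m} (X : Subset n) (A : Subset m) → Unique (memberPairs X A)
  memberPairs-unique X A = Unique.cartesianProduct⁺ (members-unique X) (members-unique A)

  length-memberPairs : ∀ {n m} (X : Subset n) (A : Subset m) → length (memberPairs X A) ≡ ∣ X ∣ * ∣ A ∣
  length-memberPairs X A = trans (length-product (members X)) (cong₂ _*_ (length-members X) (length-members A))
    where
    length-product : ∀ xs → length (cartesianProduct xs (members A)) ≡ length xs * length (members A)
    length-product []       = refl
    length-product (x ∷ xs) = trans (length-++ (map (x ,_) (members A)))
                                    (cong₂ _+_ (length-map (x ,_) (members A)) (length-product xs))

  𝟙 : ∀ {ℓ} {P : Set ℓ} → Dec P → ℕ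
  𝟙 (yes _) = 1
  𝟙 (no _)  = 0

  𝟙-mono : ∀ {ℓ} {P Q : Set ℓ} → (P → Q) → (P? : Dec P) (Q? : Dec Q) → 𝟙 P? ≤ 𝟙 Q?
  𝟙-mono P⇒Q (yes P) (yes _) = ℕₚ.≤-refl
  𝟙-mono P⇒Q (yes P) (no ¬Q) = contradiction (P⇒Q P) ¬Q
  𝟙-mono P⇒Q (no _)  _       = z≤n

  sumOver : ∀ {X : Set} → List X → (X → ℕ) → ℕ
  sumOver []       h = 0
  sumOver (x ∷ xs) h = h x + sumOver xs h

  sumOver-+ : ∀ {X : Set} (xs : List X) (g h : X → ℕ) →
              sumOver xs (λ x → g x + h x) ≡ sumOver xs g + sumOver xs h
  sumOver-+ []       g h = refl
  sumOver-+ (x ∷ xs) g h rewrite sumOver-+ xs g h = interchange (g x) (h x) (sumOver xs g) (sumOver xs h)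

  sumOver-zero : ∀ {X : Set} (xs : List X) → sumOver xs (λ _ → 0) ≡ 0
  sumOver-zero []       = refl
  sumOver-zero (_ ∷ xs) = sumOver-zero xs

  sumOver-𝟙≤1 : ∀ {X : Set} {ℓ} {P : X → Set ℓ} (P? : ∀ x → Dec (P x)) → (∀ {x y} → P x → P y → x ≡ y) →
                ∀ {xs} → Unique xs → sumOver xs (λ x → 𝟙 (P? x)) ≤ 1
  sumOver-𝟙≤1 P? unique {[]}     []               = z≤n
  sumOver-𝟙≤1 P? unique {x ∷ xs} (x∉xs ∷ distinct) with P? x
  ... | no _   = sumOver-𝟙≤1 P? unique distinct
  ... | yes Px = ℕₚ.≤-reflexive (cong suc (none x∉xs))
    where
    none : ∀ {ys} → All (x ≢_) ys → sumOver ys (λ y → 𝟙 (P? y)) ≡ 0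
    none {[]}     []           = refl
    none {y ∷ ys} (x≢y ∷ x∉ys) with P? y
    ... | yes Py = contradiction (unique Px Py) x≢y
    ... | no _   = none x∉ys

  below-average : ∀ {X : Set} (xs : List X) (h : X → ℕ) → xs ≢ [] → ∃ λ x → length xs * h x ≤ sumOver xs h
  below-average []           h []≢[] = contradiction refl []≢[]
  below-average (x ∷ [])     h _     = x , ℕₚ.≤-refl
  below-average (x ∷ y ∷ xs) h _ with below-average (y ∷ xs) h (λ ())
  ... | z , avg with ℕₚ.≤-total (h x) (h z)
  ...   | inj₁ hx≤hz = x , ℕₚ.+-monoʳ-≤ (h x) (ℕₚ.≤-trans (ℕₚ.*-monoʳ-≤ (length (y ∷ xs)) hx≤hz) avg)
  ...   | inj₂ hz≤hx = z , ℕₚ.+-mono-≤ hz≤hx avg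

  module Collisions {E : Set} {n : ℕ} where

    hits : (E → Fin n) → E → List E → ℕ
    hits g e []         = 0
    hits g e (e′ ∷ es) = 𝟙 (g e ≟ g e′) + hits g e es

    collisions : (E → Fin n) → List E → ℕ
    collisions g []       = 0
    collisions g (e ∷ es) = hits g e es + collisions g es

    hits-positive : ∀ g {e} es → Any (λ e′ → g e ≡ g e′) es → 1 ≤ hits g e es
    hits-positive g {e} (e′ ∷ es) (here ge≡ge′) with g e ≟ g e′
    ... | yes _ = s≤s z≤n
    ... | no ge≢ge′ = contradiction ge≡ge′ ge≢ge′
    hits-positive g (e′ ∷ es) (there hit) = ℕₚ.≤-trans (hits-positive g es hit) (ℕₚ.m≤n+m _ _)

    image-bound : ∀ g (S : Subset n) es → All (λ e → g e ∈ S) es → length es ≤ ∣ S ∣ + collisions g es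
    image-bound g S []       []                 = z≤n
    image-bound g S (e ∷ es) (ge∈S ∷ images∈S) with any? (λ e′ → g e ≟ g e′) es
    ... | yes hit = begin
      suc (length es)                             ≤⟨ s≤s (image-bound g S es images∈S) ⟩
      suc (∣ S ∣ + collisions g es)               ≡⟨ ℕₚ.+-suc ∣ S ∣ _ ⟨
      ∣ S ∣ + (1 + collisions g es)               ≤⟨ ℕₚ.+-monoʳ-≤ ∣ S ∣ (ℕₚ.+-monoˡ-≤ _ (hits-positive g es hit)) ⟩
      ∣ S ∣ + (hits g e es + collisions g es)     ∎
      where open ℕₚ.≤-Reasoning
    ... | no miss = begin
      suc (length es)                             ≤⟨ s≤s (image-bound g (S - g e) es (rest (¬Any⇒All¬ es miss) images∈S)) ⟩
      suc (∣ S - g e ∣ + collisions g es)         ≤⟨ ℕₚ.+-monoˡ-≤ _ (x∈p⇒∣p-x∣<∣p∣ ge∈S) ⟩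
      ∣ S ∣ + collisions g es                     ≤⟨ ℕₚ.+-monoʳ-≤ ∣ S ∣ (ℕₚ.m≤n+m _ (hits g e es)) ⟩
      ∣ S ∣ + (hits g e es + collisions g es)     ∎
      where
      open ℕₚ.≤-Reasoning
      -- the value g e is not taken again, so the rest of the image lies in S - g e
      rest : ∀ {es′} → All (λ e′ → g e ≢ g e′) es′ → All (λ e′ → g e′ ∈ S) es′ →
             All (λ e′ → g e′ ∈ S - g e) es′
      rest []               []           = []
      rest (ge≢ge′ ∷ miss′) (ge′∈S ∷ ∈S) =
        x∈p∧x≢y⇒x∈p-y ge′∈S (λ ge′≡ge → ge≢ge′ (sym ge′≡ge)) ∷ rest miss′ ∈S

    collisions-mono : ∀ h g → (∀ e e′ → h e ≡ h e′ → g e ≡ g e′) → ∀ es → collisions h es ≤ collisions g es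
    collisions-mono h g h⇒g []       = z≤n
    collisions-mono h g h⇒g (e ∷ es) = ℕₚ.+-mono-≤ (hits-mono es) (collisions-mono h g h⇒g es)
      where
      hits-mono : ∀ es′ → hits h e es′ ≤ hits g e es′
      hits-mono []          = z≤n
      hits-mono (e′ ∷ es′) = ℕₚ.+-mono-≤ (𝟙-mono (h⇒g e e′) (h e ≟ h e′) (g e ≟ g e′)) (hits-mono es′)

    collisions-injective : ∀ {ℓ} {P : E → Set ℓ} g → (∀ {e e′} → P e → P e′ → g e ≡ g e′ → e ≡ e′) →
                           ∀ {es} → All P es → Unique es → collisions g es ≡ 0
    collisions-injective {P = P} g inj {[]}     []         []               = refl
    collisions-injective {P = P} g inj {e ∷ es} (Pe ∷ Pes) (e∉es ∷ unique) =
      cong₂ _+_ (no-hits Pes e∉es) (collisions-injective g inj Pes unique)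
      where
      no-hits : ∀ {es′} → All P es′ → All (e ≢_) es′ → hits g e es′ ≡ 0
      no-hits {[]}       []          []             = refl
      no-hits {e′ ∷ es′} (Pe′ ∷ Ps) (e≢e′ ∷ e∉es′) with g e ≟ g e′
      ... | yes ge≡ge′ = contradiction (inj Pe Pe′ ge≡ge′) e≢e′
      ... | no _        = no-hits Ps e∉es′

    module _ {Ξ : Set} (f : Ξ → E → Fin n) (ξs : List Ξ)
             (rare : ∀ {e e′} → e ≢ e′ → sumOver ξs (λ ξ → 𝟙 (f ξ e ≟ f ξ e′)) ≤ 1) where

      sum-hits : ∀ {e} es → All (e ≢_) es → sumOver ξs (λ ξ → hits (f ξ) e es) ≤ length es
      sum-hits []         []            = ℕₚ.≤-reflexive (sumOver-zero ξs)
      sum-hits {e} (e′ ∷ es) (e≢e′ ∷ e∉es) = begin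
        sumOver ξs (λ ξ → 𝟙 (f ξ e ≟ f ξ e′) + hits (f ξ) e es)               ≡⟨ sumOver-+ ξs _ _ ⟩
        sumOver ξs (λ ξ → 𝟙 (f ξ e ≟ f ξ e′)) + sumOver ξs (λ ξ → hits (f ξ) e es)
                                                                             ≤⟨ ℕₚ.+-mono-≤ (rare e≢e′) (sum-hits es e∉es) ⟩
        suc (length es)                                                      ∎
        where open ℕₚ.≤-Reasoning

      sum-collisions : ∀ es → Unique es → 2 * sumOver ξs (λ ξ → collisions (f ξ) es) ≤ length es * length es
      sum-collisions []       []               = ℕₚ.≤-reflexive (cong (2 *_) (sumOver-zero ξs))
      sum-collisions (e ∷ es) (e∉es ∷ unique) = begin
        2 * sumOver ξs (λ ξ → hits (f ξ) e es + collisions (f ξ) es)   ≡⟨ cong (2 *_) (sumOver-+ ξs _ _) ⟩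
        2 * (H + C)                                                    ≡⟨ ℕₚ.*-distribˡ-+ 2 H C ⟩
        2 * H + 2 * C                                                  ≤⟨ ℕₚ.+-mono-≤ (ℕₚ.*-monoʳ-≤ 2 (sum-hits es e∉es))
                                                                                       (sum-collisions es unique) ⟩
        2 * l + l * l                                                  ≤⟨ ℕₚ.n≤1+n _ ⟩
        1 + (2 * l + l * l)                                            ≡⟨ square-suc l ⟩
        suc l * suc l                                                  ∎
        where
        open ℕₚ.≤-Reasoning
        H = sumOver ξs (λ ξ → hits (f ξ) e es)
        C = sumOver ξs (λ ξ → collisions (f ξ) es)
        l = length es
        square-suc : ∀ l → 1 + (2 * l + l * l) ≡ (1 + l) * (1 + l)
        square-suc = solve-∀

    injection-bound : ∀ {ℓ} {P : E → Set ℓ} g (S : Subset n) {es} → All P es → Unique es →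
                      (∀ {e} → P e → g e ∈ S) → (∀ {e e′} → P e → P e′ → g e ≡ g e′ → e ≡ e′) →
                      length es ≤ ∣ S ∣
    injection-bound g S {es} Pes unique g∈S g-injective = begin
      length es                    ≤⟨ image-bound g S es (All.map g∈S Pes) ⟩
      ∣ S ∣ + collisions g es      ≡⟨ cong (∣ S ∣ +_) (collisions-injective g g-injective Pes unique) ⟩
      ∣ S ∣ + 0                    ≡⟨ ℕₚ.+-identityʳ ∣ S ∣ ⟩
      ∣ S ∣                        ∎
      where open ℕₚ.≤-Reasoning

module Arithmetic where
  open import Data.Nat as ℕ using (_+_; _*_; _<_; z≤n; s≤s)
  open import Data.Nat.Properties
  open import Data.Nat.Tactic.RingSolver using (solve)
  open import Data.List using ([]; _∷_)
  open import Data.Sum using (inj₁; inj₂)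
  open import Relation.Binary.PropositionalEquality
  open import Relation.Nullary using (contradiction)

  averaging-bound : ∀ p T S D → 0 < p → T ⊓ p ≤ S + D → 2 * (p * D) ≤ (T ⊓ p) * (T ⊓ p) →
                    p * T ≤ S * (p + 2 * T)
  averaging-bound p T S D 0<p N≤S+D 2pD≤N² with ≤-total T p
  ... | inj₁ T≤p rewrite m≤n⇒m⊓n≡m T≤p = +-cancelʳ-≤ (2 * (T * T)) (p * T) (S * (p + 2 * T)) (begin
    p * T + 2 * (T * T)                  ≡⟨ solve (p ∷ T ∷ []) ⟩
    T * (p + 2 * T)                      ≤⟨ *-monoˡ-≤ (p + 2 * T) N≤S+D ⟩
    (S + D) * (p + 2 * T)                ≡⟨ *-distribʳ-+ (p + 2 * T) S D ⟩
    S * (p + 2 * T) + D * (p + 2 * T)    ≤⟨ +-monoʳ-≤ (S * (p + 2 * T)) D[p+2T]≤2T² ⟩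
    S * (p + 2 * T) + 2 * (T * T)        ∎)
    where
    open ≤-Reasoning
    instance _ = ℕ.>-nonZero (*-monoʳ-< 2 0<p)
    D[p+2T]≤2T² : D * (p + 2 * T) ≤ 2 * (T * T)
    D[p+2T]≤2T² = *-cancelˡ-≤ (2 * p) (begin
      (2 * p) * (D * (p + 2 * T))   ≡⟨ solve (p ∷ D ∷ T ∷ []) ⟩
      (2 * (p * D)) * (p + 2 * T)   ≤⟨ *-monoˡ-≤ (p + 2 * T) 2pD≤N² ⟩
      (T * T) * (p + 2 * T)         ≤⟨ *-monoʳ-≤ (T * T) (+-monoʳ-≤ p (*-monoʳ-≤ 2 T≤p)) ⟩
      (T * T) * (p + 2 * p)         ≤⟨ *-monoʳ-≤ (T * T) (m≤m+n (p + 2 * p) p) ⟩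
      (T * T) * ((p + 2 * p) + p)   ≡⟨ solve (p ∷ T ∷ []) ⟩
      (2 * p) * (2 * (T * T))       ∎)
  ... | inj₂ p≤T rewrite m≥n⇒m⊓n≡n p≤T = begin
    p * T               ≤⟨ *-monoˡ-≤ T p≤2S ⟩
    (2 * S) * T         ≡⟨ solve (S ∷ T ∷ []) ⟩
    S * (2 * T)         ≤⟨ *-monoʳ-≤ S (m≤n+m (2 * T) p) ⟩
    S * (p + 2 * T)     ∎
    where
    open ≤-Reasoning
    instance _ = ℕ.>-nonZero 0<p
    2D≤p : 2 * D ≤ p
    2D≤p = *-cancelˡ-≤ p (begin
      p * (2 * D)     ≡⟨ solve (p ∷ D ∷ []) ⟩
      2 * (p * D)     ≤⟨ 2pD≤N² ⟩
      p * p           ∎)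
    p≤2S : p ≤ 2 * S
    p≤2S = +-cancelʳ-≤ p p (2 * S) (begin
      p + p               ≡⟨ solve (p ∷ []) ⟩
      2 * p               ≤⟨ *-monoʳ-≤ 2 N≤S+D ⟩
      2 * (S + D)         ≡⟨ *-distribˡ-+ 2 S D ⟩
      2 * S + 2 * D       ≤⟨ +-monoʳ-≤ (2 * S) 2D≤p ⟩
      2 * S + p           ∎)

  direct-bound : ∀ p T S → T ≤ S → p * T ≤ S * (p + 2 * T)
  direct-bound p T S T≤S = begin
    p * T            ≤⟨ *-monoʳ-≤ p T≤S ⟩
    p * S            ≡⟨ *-comm p S ⟩
    S * p            ≤⟨ *-monoʳ-≤ S (m≤m+n p (2 * T)) ⟩
    S * (p + 2 * T)  ∎
    where open ≤-Reasoning

  -- s is large at scale K relative to p: s ≥ p K / (p + 4K) (roughly s ≥ min(K, p) / 5)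
  Large : ℕ → ℕ → ℕ → Set
  Large p K s = p * K ≤ s * (p + 4 * K)

  large-base : ∀ p K s → K ≤ s → Large p K s
  large-base p K s K≤s = begin
    p * K            ≤⟨ *-monoʳ-≤ p K≤s ⟩
    p * s            ≡⟨ *-comm p s ⟩
    s * p            ≤⟨ *-monoʳ-≤ s (m≤m+n p (4 * K)) ⟩
    s * (p + 4 * K)  ∎
    where open ≤-Reasoning

  large-positive : ∀ p K s → 0 < p → 0 < K → Large p K s → 0 < s
  large-positive p K 0       0<p 0<K pK≤0 = contradiction pK≤0 (<⇒≱ (*-mono-≤ 0<p 0<K))
  large-positive p K (suc s) _   _   _    = s≤s z≤n

  large-step : ∀ p m M s s′ → 2 ≤ m → 0 < p → 0 < M → Large p M s →
               p * (s * m) ≤ s′ * (p + 2 * (s * m)) → Large p (M * m) s′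
  large-step p m M s s′ 2≤m 0<p 0<M large-s s′-bound = *-cancelˡ-≤ s (begin
    s * (p * (M * m))                           ≡⟨ solve (s ∷ p ∷ M ∷ m ∷ []) ⟩
    M * (p * (s * m))                           ≤⟨ *-monoʳ-≤ M s′-bound ⟩
    M * (s′ * (p + 2 * (s * m)))                ≡⟨ solve (M ∷ s′ ∷ p ∷ s ∷ m ∷ []) ⟩
    s′ * (p * M + 2 * ((s * m) * M))            ≤⟨ *-monoʳ-≤ s′ (+-monoˡ-≤ (2 * ((s * m) * M)) large-s) ⟩
    s′ * (s * (p + 4 * M) + 2 * ((s * m) * M))  ≡⟨ solve (s′ ∷ s ∷ p ∷ M ∷ m ∷ []) ⟩
    s * (s′ * ((p + 4 * M) + 2 * (m * M)))      ≤⟨ *-monoʳ-≤ s (*-monoʳ-≤ s′ scale) ⟩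
    s * (s′ * (p + 4 * (M * m)))                ∎)
    where
    open ≤-Reasoning
    instance _ = ℕ.>-nonZero (large-positive p M s 0<p 0<M large-s)
    scale : (p + 4 * M) + 2 * (m * M) ≤ p + 4 * (M * m)
    scale = begin
      (p + 4 * M) + 2 * (m * M)       ≡⟨ solve (p ∷ M ∷ m ∷ []) ⟩
      p + (2 * (2 * M) + 2 * (m * M)) ≤⟨ +-monoʳ-≤ p (+-monoˡ-≤ (2 * (m * M)) (*-monoʳ-≤ 2 (*-monoˡ-≤ M 2≤m))) ⟩
      p + (2 * (m * M) + 2 * (m * M)) ≡⟨ solve (p ∷ M ∷ m ∷ []) ⟩
      p + 4 * (M * m)                 ∎

  -- a large s is at least min(K, p) / 8 (in fact min(K, p) / 5)
  large⇒bound : ∀ p K s → 0 < p → Large p K s → K ⊓ p ≤ 8 * s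
  large⇒bound p K s 0<p large with ≤-total K p
  ... | inj₁ K≤p rewrite m≤n⇒m⊓n≡m K≤p = ≤-trans (*-cancelˡ-≤ p {{ℕ.>-nonZero 0<p}} (begin
    p * K               ≤⟨ large ⟩
    s * (p + 4 * K)     ≤⟨ *-monoʳ-≤ s (+-monoʳ-≤ p (*-monoʳ-≤ 4 K≤p)) ⟩
    s * (p + 4 * p)     ≡⟨ solve (s ∷ p ∷ []) ⟩
    p * (5 * s)         ∎)) (*-monoˡ-≤ s (m≤m+n 5 3))
    where open ≤-Reasoning
  ... | inj₂ p≤K rewrite m≥n⇒m⊓n≡n p≤K = ≤-trans (*-cancelʳ-≤ p (5 * s) K {{ℕ.>-nonZero (<-≤-trans 0<p p≤K)}} (begin
    p * K               ≤⟨ large ⟩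
    s * (p + 4 * K)     ≤⟨ *-monoʳ-≤ s (+-monoˡ-≤ (4 * K) p≤K) ⟩
    s * (K + 4 * K)     ≡⟨ solve (s ∷ K ∷ []) ⟩
    (5 * s) * K         ∎)) (*-monoˡ-≤ s (m≤m+n 5 3))
    where open ≤-Reasoning

  -- room for the padding: 4N + 1 ≤ 8N when N ≥ 1
  4N+1≤8N : ∀ N → 1 ≤ N → ((N + N) + (N + N)) + 1 ≤ 8 * N
  4N+1≤8N N 1≤N = begin
    ((N + N) + (N + N)) + 1      ≤⟨ +-monoʳ-≤ _ (≤-trans 1≤N (m≤n*m N 4)) ⟩
    ((N + N) + (N + N)) + 4 * N  ≡⟨ solve (N ∷ []) ⟩
    8 * N                        ∎
    where open ≤-Reasoning

module KeyStep {p : ℕ} .{{_ : NonZero p}} (p-prime : Prime p) where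
  import Data.Nat as ℕ
  import Data.Nat.Properties as ℕₚ
  open import Data.Fin using (Fin)
  open import Data.Fin.Properties using (_≟_; any?)
  open import Data.Fin.Subset using (_∈_)
  open import Data.Fin.Subset.Properties using (_∈?_)
  open import Data.List using (List; []; length; take; allFin)
  open import Data.List.Properties using (length-take; length-tabulate)
  open import Data.List.Relation.Unary.All as All using (All)
  open import Data.List.Relation.Unary.Unique.Propositional using (Unique)
  import Data.List.Relation.Unary.All.Properties as All
  import Data.List.Relation.Unary.Unique.Propositional.Properties as Unique
  open import Function using (id)
  open import Data.Product using (∃; ∃₂; _×_; _,_)
  open import Data.Product.Properties using (≡-dec)
  open import Relation.Nullary using (Dec; yes; no; ¬_; contradiction)
  open import Relation.Nullary.Decidable using (_×-dec_; ¬?)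
  open import Algebra.Bundles using (CommutativeRing)
  open import Relation.Binary.PropositionalEquality
  open ResidueRing
  open PrimeField
  open Counting
  open Arithmetic

  open CommutativeRing (𝔽 {p}) using (_+_; _*_; _-_; 0#; ring; commutativeSemiring; +-assoc; *-comm; distribˡ; zeroˡ)
  open import Algebra.Properties.Ring ring using (//-rightDividesˡ; +-cancelʳ; x∙y⁻¹≈ε⇒x≈y)
  open import Algebra.Solver.Ring.NaturalCoefficients.Default commutativeSemiring
  open Collisions {Fin p × Fin p} {p}

  Point : Set
  Point = Fin p × Fin p

  line : Fin p → Point → Fin p
  line ξ (x , a) = x + ξ * a

  line-collision : ∀ ξ {x a x′ a′} → line ξ (x , a) ≡ line ξ (x′ , a′) → ξ * (a - a′) ≡ x′ - x
  line-collision ξ {x} {a} {x′} {a′} same-line = +-cancelʳ (x + ξ * a′) _ _ (begin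
    ξ * (a - a′) + (x + ξ * a′)        ≡⟨ solve 3 (λ u x v → u :+ (x :+ v) := x :+ (u :+ v)) refl (ξ * (a - a′)) x (ξ * a′) ⟩
    x + (ξ * (a - a′) + ξ * a′)        ≡⟨ cong (x +_) (distribˡ ξ (a - a′) a′) ⟨
    x + ξ * ((a - a′) + a′)            ≡⟨ cong (λ t → x + ξ * t) (//-rightDividesˡ a′ a) ⟩
    x + ξ * a                          ≡⟨ same-line ⟩
    x′ + ξ * a′                        ≡⟨ cong (_+ ξ * a′) (//-rightDividesˡ x x′) ⟨
    (x′ - x) + x + ξ * a′              ≡⟨ +-assoc (x′ - x) x (ξ * a′) ⟩
    (x′ - x) + (x + ξ * a′)            ∎)
    where open ≡-Reasoning

  scaled-line : ∀ ξ d {e} x a → ξ * d ≡ e → d * x + e * a ≡ d * line ξ (x , a)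
  scaled-line ξ d x a refl = solve 4 (λ d ξ x a → d :* x :+ (ξ :* d) :* a := d :* (x :+ ξ :* a)) refl d ξ x a

  shifted-line : ∀ ξ d {e} y x a → ξ * d ≡ e → (d * x + e * a) + (y * d) * a ≡ d * line (ξ + y) (x , a)
  shifted-line ξ d y x a refl =
    solve 5 (λ d ξ y x a → (d :* x :+ (ξ :* d) :* a) :+ (y :* d) :* a := d :* (x :+ (ξ :+ y) :* a)) refl d ξ y x a

  difference≢0 : ∀ {a a′} → a ≢ a′ → a - a′ ≢ 0#
  difference≢0 {a} {a′} a≢a′ a-a′≡0 = a≢a′ (x∙y⁻¹≈ε⇒x≈y a a′ a-a′≡0)

  common-slope-unique : ∀ {e e′} → e ≢ e′ → ∀ {ξ η} →
                        line ξ e ≡ line ξ e′ → line η e ≡ line η e′ → ξ ≡ η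
  common-slope-unique {x , a} {x′ , a′} e≢e′ {ξ} {η} on-ξ on-η with a ≟ a′
  ... | yes refl = contradiction (cong (_, a) (+-cancelʳ (ξ * a) x x′ on-ξ)) e≢e′
  ... | no a≢a′  = *-cancelˡ p-prime (difference≢0 a≢a′) (begin
    (a - a′) * ξ     ≡⟨ *-comm (a - a′) ξ ⟩
    ξ * (a - a′)     ≡⟨ line-collision ξ on-ξ ⟩
    x′ - x           ≡⟨ line-collision η on-η ⟨
    η * (a - a′)     ≡⟨ *-comm η (a - a′) ⟩
    (a - a′) * η     ∎)
    where open ≡-Reasoning

  rare-collisions : ∀ {e e′} → e ≢ e′ → sumOver (allFin p) (λ ξ → 𝟙 (line ξ e ≟ line ξ e′)) ≤ 1
  rare-collisions e≢e′ = sumOver-𝟙≤1 (λ ξ → _ ≟ _) (common-slope-unique e≢e′) (Unique.allFin⁺ p)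

  module _ (X A : Subset p) where

    InGrid : Point → Set
    InGrid (x , a) = x ∈ X × a ∈ A

    CollisionSlope : Fin p → Set
    CollisionSlope ξ = ∃₂ λ x₁ x₂ → ∃₂ λ a₁ a₂ →
      x₁ ∈ X × x₂ ∈ X × a₁ ∈ A × a₂ ∈ A × a₁ ≢ a₂ × line ξ (x₁ , a₁) ≡ line ξ (x₂ , a₂)

    collisionSlope? : ∀ ξ → Dec (CollisionSlope ξ)
    collisionSlope? ξ = any? λ x₁ → any? λ x₂ → any? λ a₁ → any? λ a₂ →
      x₁ ∈? X ×-dec x₂ ∈? X ×-dec a₁ ∈? A ×-dec a₂ ∈? A ×-dec ¬? (a₁ ≟ a₂) ×-dec
      line ξ (x₁ , a₁) ≟ line ξ (x₂ , a₂)

    collision⇒slope : ∀ ξ {e e′} → InGrid e → InGrid e′ → e ≢ e′ → line ξ e ≡ line ξ e′ → CollisionSlope ξ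
    collision⇒slope ξ {x , a} {x′ , a′} (x∈ , a∈) (x′∈ , a′∈) e≢e′ on-ξ with a ≟ a′
    ... | yes refl = contradiction (cong (_, a) (+-cancelʳ (ξ * a) x x′ on-ξ)) e≢e′
    ... | no a≢a′  = x , x′ , a , a′ , x∈ , x′∈ , a∈ , a′∈ , a≢a′ , on-ξ

    module _ (S : Subset p)
      (sumset : ∀ {x a x₁ x₂ a₁ a₂} → x ∈ X → a ∈ A → x₁ ∈ X → x₂ ∈ X → a₁ ∈ A → a₂ ∈ A →
                (a₁ - a₂) * x + (x₁ - x₂) * a ∈ S) where

      -- A collision slope is a ratio ξ = (x₂ - x₁)/(a₁ - a₂), so (a₁ - a₂) · line ξ maps the grid
      -- into S, identifying no more pairs than line ξ: |S| ≥ (number of grid points) - (collisions).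
      image-at-slope : ∀ ξ → CollisionSlope ξ → ∀ es → All InGrid es → length es ≤ ∣ S ∣ ℕ.+ collisions (line ξ) es
      image-at-slope ξ (x₁ , x₂ , a₁ , a₂ , x₁∈ , x₂∈ , a₁∈ , a₂∈ , a₁≢a₂ , on-ξ) es in-grid =
        ℕₚ.≤-trans (image-bound g S es (All.map g∈S in-grid))
                   (ℕₚ.+-monoʳ-≤ ∣ S ∣ (collisions-mono g (line ξ) same-line es))
        where
        d = a₁ - a₂
        g : Point → Fin p
        g e = d * line ξ e
        g∈S : ∀ {e} → InGrid e → g e ∈ S
        g∈S {x , a} (x∈ , a∈) =
          subst (_∈ S) (scaled-line ξ d x a (line-collision ξ on-ξ)) (sumset x∈ a∈ x₂∈ x₁∈ a₁∈ a₂∈)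
        same-line : ∀ e e′ → g e ≡ g e′ → line ξ e ≡ line ξ e′
        same-line e e′ = *-cancelˡ p-prime (difference≢0 a₁≢a₂)

    module _ (S : Subset p) {y : Fin p}
      (sumset : ∀ {x a x₁ x₂ a₁ a₂} → x ∈ X → a ∈ A → x₁ ∈ X → x₂ ∈ X → a₁ ∈ A → a₂ ∈ A →
                ((a₁ - a₂) * x + (x₁ - x₂) * a) + (y * (a₁ - a₂)) * a ∈ S) where

      -- If q = (x₂ - x₁)/(a₁ - a₂) is a collision slope but q + y is not, then
      -- (a₁ - a₂) · line (q + y) embeds X × A into S.
      grid-embeds : ∀ {q} → CollisionSlope q → ¬ CollisionSlope (q + y) → ∣ X ∣ ℕ.* ∣ A ∣ ≤ ∣ S ∣
      grid-embeds {q} (x₁ , x₂ , a₁ , a₂ , x₁∈ , x₂∈ , a₁∈ , a₂∈ , a₁≢a₂ , on-q) no-slope =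
        subst (_≤ ∣ S ∣) (length-memberPairs X A)
          (injection-bound h S (memberPairs-∈ X A) (memberPairs-unique X A) h∈S h-injective)
        where
        d = a₁ - a₂
        h : Point → Fin p
        h e = d * line (q + y) e
        h∈S : ∀ {e} → InGrid e → h e ∈ S
        h∈S {x , a} (x∈ , a∈) =
          subst (_∈ S) (shifted-line q d y x a (line-collision q on-q)) (sumset x∈ a∈ x₂∈ x₁∈ a₁∈ a₂∈)
        h-injective : ∀ {e e′} → InGrid e → InGrid e′ → h e ≡ h e′ → e ≡ e′
        h-injective {e} {e′} e∈ e′∈ he≡he′ with ≡-dec _≟_ _≟_ e e′
        ... | yes e≡e′ = e≡e′
        ... | no e≢e′  = contradiction (collision⇒slope (q + y) e∈ e′∈ e≢e′
                                         (*-cancelˡ p-prime (difference≢0 a₁≢a₂) he≡he′)) no-slope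

    zero-slope : 0# ∈ X → ∀ {b₁ b₂} → b₁ ∈ A → b₂ ∈ A → b₁ ≢ b₂ → CollisionSlope 0#
    zero-slope 0∈X {b₁} {b₂} b₁∈ b₂∈ b₁≢b₂ =
      0# , 0# , b₁ , b₂ , 0∈X , 0∈X , b₁∈ , b₂∈ , b₁≢b₂ , cong (0# +_) (trans (zeroˡ b₁) (sym (zeroˡ b₂)))

    -- walking from a collision slope in steps of y ≠ 0 one must leave the collision slopes
    -- before reaching a slope ξ that is not one
    slope-boundary : ∀ {y} → y ≢ 0# → CollisionSlope 0# → ∀ {ξ} → ¬ CollisionSlope ξ →
                     ∃ λ q → CollisionSlope q × ¬ CollisionSlope (q + y)
    slope-boundary {y} y≢0 slope₀ {ξ} ¬slope with any? (λ q → collisionSlope? q ×-dec ¬? (collisionSlope? (q + y)))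
    ... | yes boundary = boundary
    ... | no ¬boundary = contradiction (additive-orbit p-prime y≢0 slope₀ closed ξ) ¬slope
      where
      closed : ∀ q → CollisionSlope q → CollisionSlope (q + y)
      closed q slope with collisionSlope? (q + y)
      ... | yes slope′ = slope′
      ... | no ¬slope′ = contradiction (q , slope , ¬slope′) ¬boundary

    -- Pick a slope ξ whose line map has at most the average number of collisions on (at most p)
    -- points of X × A. If ξ is a collision slope, the scaled line map sends these points into S;
    -- otherwise a boundary slope q gives an embedding of X × A into S.
    module _ (S : Subset p) {y : Fin p} (y≢0 : y ≢ 0#)
      (sumset-G : ∀ {x a x₁ x₂ a₁ a₂} → x ∈ X → a ∈ A → x₁ ∈ X → x₂ ∈ X → a₁ ∈ A → a₂ ∈ A →
                  (a₁ - a₂) * x + (x₁ - x₂) * a ∈ S)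
      (sumset-H : ∀ {x a x₁ x₂ a₁ a₂} → x ∈ X → a ∈ A → x₁ ∈ X → x₂ ∈ X → a₁ ∈ A → a₂ ∈ A →
                  ((a₁ - a₂) * x + (x₁ - x₂) * a) + (y * (a₁ - a₂)) * a ∈ S)
      (0∈X : 0# ∈ X) {b₁ b₂ : Fin p} (b₁∈A : b₁ ∈ A) (b₂∈A : b₂ ∈ A) (b₁≢b₂ : b₁ ≢ b₂) where

      0<p : 0 ℕ.< p
      0<p = ℕ.>-nonZero⁻¹ p
      points : List Point
      points = take p (memberPairs X A)
      points-in-grid : All InGrid points
      points-in-grid = All.take⁺ p (memberPairs-∈ X A)
      points-unique : Unique points
      points-unique = Unique.take⁺ p (memberPairs-unique X A)
      length-points : length points ≡ (∣ X ∣ ℕ.* ∣ A ∣) ⊓ p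
      length-points = trans (length-take p (memberPairs X A)) (trans (ℕₚ.⊓-comm p _) (cong (_⊓ p) (length-memberPairs X A)))
      length-allFin : length (allFin p) ≡ p
      length-allFin = length-tabulate id
      allFin≢[] : allFin p ≢ []
      allFin≢[] allFin≡[] = ℕₚ.<⇒≢ 0<p (trans (sym (cong length allFin≡[])) length-allFin)

      key-step : p ℕ.* (∣ X ∣ ℕ.* ∣ A ∣) ≤ ∣ S ∣ ℕ.* (p ℕ.+ 2 ℕ.* (∣ X ∣ ℕ.* ∣ A ∣))
      key-step with below-average (allFin p) (λ ξ → collisions (line ξ) points) allFin≢[]
      ... | ξ , ξ-below-average with collisionSlope? ξ
      ... | yes slope = averaging-bound p (∣ X ∣ ℕ.* ∣ A ∣) ∣ S ∣ D 0<p N≤S+D 2pD≤N²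
        where
        D = collisions (line ξ) points
        N≤S+D : (∣ X ∣ ℕ.* ∣ A ∣) ⊓ p ≤ ∣ S ∣ ℕ.+ D
        N≤S+D = subst (_≤ ∣ S ∣ ℕ.+ D) length-points (image-at-slope S sumset-G ξ slope points points-in-grid)
        2pD≤N² : 2 ℕ.* (p ℕ.* D) ≤ ((∣ X ∣ ℕ.* ∣ A ∣) ⊓ p) ℕ.* ((∣ X ∣ ℕ.* ∣ A ∣) ⊓ p)
        2pD≤N² = begin
          2 ℕ.* (p ℕ.* D)                          ≡⟨ cong (λ n → 2 ℕ.* (n ℕ.* D)) length-allFin ⟨
          2 ℕ.* (length (allFin p) ℕ.* D)          ≤⟨ ℕₚ.*-monoʳ-≤ 2 {length (allFin p) ℕ.* D} ξ-below-average ⟩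
          2 ℕ.* sumOver (allFin p) (λ η → collisions (line η) points)
                                                   ≤⟨ sum-collisions line (allFin p) rare-collisions points points-unique ⟩
          length points ℕ.* length points          ≡⟨ cong₂ ℕ._*_ length-points length-points ⟩
          ((∣ X ∣ ℕ.* ∣ A ∣) ⊓ p) ℕ.* ((∣ X ∣ ℕ.* ∣ A ∣) ⊓ p) ∎
          where open ℕₚ.≤-Reasoning
      ... | no ¬slope with slope-boundary {y} y≢0 (zero-slope 0∈X b₁∈A b₂∈A b₁≢b₂) {ξ} ¬slope
      ...   | q , slope-q , ¬slope-q+y = direct-bound p _ _ (grid-embeds S {y} sumset-H {q} slope-q ¬slope-q+y)

module Growth {p : ℕ} .{{_ : NonZero p}} (p-prime : Prime p) (A : Subset p) where
  open import Data.Nat as ℕ using (zero; z≤n; s≤s)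
  import Data.Nat.Properties as ℕₚ
  open import Data.Fin.Properties using (_≟_)
  open import Data.Fin.Subset using (_∈_)
  open import Data.Fin.Subset.Properties using (x∈p⇒∣p-x∣<∣p∣)
  open import Data.Product using (∃; _×_; _,_)
  open import Data.Sum using ([_,_]′)
  open import Data.Unit using (⊤)
  open import Relation.Nullary using (yes; no)
  open import Algebra.Bundles using (CommutativeRing)
  open import Relation.Binary.PropositionalEquality
  open ResidueRing
  open PrimeField
  open Sumsets
  open Counting
  open Arithmetic

  open CommutativeRing (𝔽 {p}) using (_+_; _*_; _-_; 0#; ring; commutativeSemiring; -‿inverseʳ)
  open import Algebra.Properties.Ring ring using (//-rightDividesˡ)
  open import Algebra.Solver.Ring.NaturalCoefficients.Default commutativeSemiring
  open KeyStep p-prime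
  open Collisions using (injection-bound)

  P T S : ℕ → Subset p
  P k = prodPow k A
  T k = sumPow (8 ^ k) (P k)
  S k = T k ⊖ T k

  P-nonempty : ∀ {c} → c ∈ A → ∀ k → ∃ λ y → y ∈ P k
  P-nonempty c∈A k with prodPow-witness (λ _ → ⊤) c∈A _ _ k
  ... | y , y∈P , _ = y , y∈P

  0∈S : ∀ {c} → c ∈ A → ∀ k → 0# ∈ S k
  0∈S c∈A k with P-nonempty c∈A k
  ... | y , y∈P with sumPow-nonempty y∈P (8 ^ k)
  ... | u , u∈T = subst (_∈ S k) (-‿inverseʳ u) (∈⊖⁺ u∈T u∈T)

  -- With x + w = u, x₁ + w₁ = u₁, x₂ + w₂ = u₂ (that is, x = u - w, …), d + a₂ = a₁ and e + x₂ = x₁: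
  --   (d x + e a) + (u a₂ + w a₁ + w₁ a + u₂ a) = u a₁ + w a₂ + u₁ a + w₂ a
  expansion : ∀ {d e a a₁ a₂ x x₁ x₂ u u₁ u₂ w w₁ w₂} →
              d + a₂ ≡ a₁ → e + x₂ ≡ x₁ → x + w ≡ u → x₁ + w₁ ≡ u₁ → x₂ + w₂ ≡ u₂ →
              (d * x + e * a) + ((u * a₂ + w * a₁) + (w₁ * a + u₂ * a)) ≡ (u * a₁ + w * a₂) + (u₁ * a + w₂ * a)
  expansion {d} {e} {a} {_} {a₂} {x} {_} {x₂} {_} {_} {_} {w} {w₁} {w₂} refl refl refl refl refl =
    solve 9 (λ d e a a₂ x x₂ w w₁ w₂ →
      (d :* x :+ e :* a) :+ (((x :+ w) :* a₂ :+ w :* (d :+ a₂)) :+ (w₁ :* a :+ (x₂ :+ w₂) :* a))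
      := ((x :+ w) :* (d :+ a₂) :+ w :* a₂) :+ (((e :+ x₂) :+ w₁) :* a :+ w₂ :* a))
      refl d e a a₂ x x₂ w w₁ w₂

  extra-term : ∀ {g V U d a₁ a₂} y a → g + V ≡ U → d + a₂ ≡ a₁ →
               (g + (y * d) * a) + (V + (y * a₂) * a) ≡ U + (y * a₁) * a
  extra-term {g} {V} {_} {d} {_} {a₂} y a refl refl =
    solve 6 (λ g V d a₂ y a → (g :+ (y :* d) :* a) :+ (V :+ (y :* a₂) :* a) := (g :+ V) :+ (y :* (d :+ a₂)) :* a)
      refl g V d a₂ y a

  scaled : ∀ j {a u} → a ∈ A → u ∈ T j → u * a ∈ sumPow (8 ^ j) (P (suc j))
  scaled j a∈A u∈T = sumPow-scale (λ y∈P → image₂⁺ _*F_ y∈P a∈A) (8 ^ j) u∈T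

  four-terms : ∀ N {Y : Subset p} {t₁ t₂ t₃ t₄} → t₁ ∈ sumPow N Y → t₂ ∈ sumPow N Y → t₃ ∈ sumPow N Y →
               t₄ ∈ sumPow N Y → (t₁ + t₂) + (t₃ + t₄) ∈ sumPow ((N ℕ.+ N) ℕ.+ (N ℕ.+ N)) Y
  four-terms N t₁∈ t₂∈ t₃∈ t₄∈ = sumPow-+ (N ℕ.+ N) (N ℕ.+ N) (sumPow-+ N N t₁∈ t₂∈) (sumPow-+ N N t₃∈ t₄∈)

  -- Writing x = u - w, x₁ = u₁ - w₁, x₂ = u₂ - w₂ with u, w, … ∈ T j, the element
  -- (a₁ - a₂) x + (x₁ - x₂) a is U - V for two sums U, V of four elements of T j · A ⊆ 8^j A^(j+1).
  difference-of-sums : ∀ j {x a x₁ x₂ a₁ a₂} → x ∈ S j → a ∈ A → x₁ ∈ S j → x₂ ∈ S j → a₁ ∈ A → a₂ ∈ A →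
    let N = 8 ^ j in ∃ λ U → ∃ λ V → U ∈ sumPow ((N ℕ.+ N) ℕ.+ (N ℕ.+ N)) (P (suc j)) ×
                                     V ∈ sumPow ((N ℕ.+ N) ℕ.+ (N ℕ.+ N)) (P (suc j)) ×
                                     ((a₁ - a₂) * x + (x₁ - x₂) * a) + V ≡ U
  difference-of-sums j {x} {a} {x₁} {x₂} {a₁} {a₂} x∈ a∈ x₁∈ x₂∈ a₁∈ a₂∈ with ∈⊖⁻ x∈ | ∈⊖⁻ x₁∈ | ∈⊖⁻ x₂∈
  ... | u , w , u∈ , w∈ , x+w≡u | u₁ , w₁ , u₁∈ , w₁∈ , x₁+w₁≡u₁ | u₂ , w₂ , u₂∈ , w₂∈ , x₂+w₂≡u₂ =
    _ , _ , four-terms N (scaled j a₁∈ u∈) (scaled j a₂∈ w∈) (scaled j a∈ u₁∈) (scaled j a∈ w₂∈)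
          , four-terms N (scaled j a₂∈ u∈) (scaled j a₁∈ w∈) (scaled j a∈ w₁∈) (scaled j a∈ u₂∈)
          , expansion {a₁ - a₂} {x₁ - x₂} {a} {a₁} {a₂} {x} {x₁} {x₂} {u} {u₁} {u₂} {w} {w₁} {w₂}
                      (//-rightDividesˡ a₂ a₁) (//-rightDividesˡ x₂ x₁) x+w≡u x₁+w₁≡u₁ x₂+w₂≡u₂
    where N = 8 ^ j

  sumset-G : ∀ j {x a x₁ x₂ a₁ a₂} → x ∈ S j → a ∈ A → x₁ ∈ S j → x₂ ∈ S j → a₁ ∈ A → a₂ ∈ A →
             (a₁ - a₂) * x + (x₁ - x₂) * a ∈ S (suc j)
  sumset-G j x∈ a∈ x₁∈ x₂∈ a₁∈ a₂∈ =
    let U , V , U∈ , V∈ , g+V≡U = difference-of-sums j x∈ a∈ x₁∈ x₂∈ a₁∈ a₂∈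
        c , c∈ = P-nonempty a∈ (suc j)
    in ∈⊖-padded {X = P (suc j)} {N = 8 ^ suc j} c∈ (ℕₚ.≤-trans (ℕₚ.m≤m+n _ 1) (4N+1≤8N (8 ^ j) (ℕₚ.m^n>0 8 j)))
                 U∈ V∈ g+V≡U

  sumset-H : ∀ i {y} → y ∈ P i → ∀ {x a x₁ x₂ a₁ a₂} → x ∈ S (suc i) → a ∈ A → x₁ ∈ S (suc i) →
             x₂ ∈ S (suc i) → a₁ ∈ A → a₂ ∈ A →
             ((a₁ - a₂) * x + (x₁ - x₂) * a) + (y * (a₁ - a₂)) * a ∈ S (suc (suc i))
  sumset-H i {y} y∈ {x} {a} {x₁} {x₂} {a₁} {a₂} x∈ a∈ x₁∈ x₂∈ a₁∈ a₂∈ =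
    let U , V , U∈ , V∈ , g+V≡U = difference-of-sums (suc i) x∈ a∈ x₁∈ x₂∈ a₁∈ a₂∈
        c , c∈ = P-nonempty a∈ (suc (suc i))
    in ∈⊖-padded {X = P (suc (suc i))} {N = 8 ^ suc (suc i)} c∈ (4N+1≤8N N (ℕₚ.m^n>0 8 (suc i)))
                 (sumPow-+ {X = P (suc (suc i))} 4N 1 U∈ (sumPow-one⁺ (extra a₁∈)))
                 (sumPow-+ {X = P (suc (suc i))} 4N 1 V∈ (sumPow-one⁺ (extra a₂∈)))
                 (extra-term {(a₁ - a₂) * x + (x₁ - x₂) * a} {V} {U} {a₁ - a₂} {a₁} {a₂} y a g+V≡U
                             (//-rightDividesˡ a₂ a₁))
    where
    N = 8 ^ suc i
    4N = (N ℕ.+ N) ℕ.+ (N ℕ.+ N)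
    extra : ∀ {a′} → a′ ∈ A → (y * a′) * a ∈ P (suc (suc i))
    extra a′∈ = image₂⁺ _*F_ (image₂⁺ _*F_ y∈ a′∈) a∈

  base : ∀ {b} → b ∈ A → ∣ A ∣ ≤ ∣ S 1 ∣
  base {b} b∈A = subst (_≤ ∣ S 1 ∣) (length-members A)
    (injection-bound (_- b) (S 1) (members-∈ A) (members-unique A) shift∈S (λ _ _ → shift-injective))
    where
    shift∈S : ∀ {a} → a ∈ A → a - b ∈ S 1
    shift∈S {a} a∈A = ∈⊖-padded {r = 1} {N = 8 ^ 1} (prodPow-one⁺ b∈A) (s≤s z≤n) (sumPow-one⁺ (prodPow-one⁺ a∈A))
                                (sumPow-one⁺ (prodPow-one⁺ b∈A)) (//-rightDividesˡ b a)
    shift-injective : ∀ {a a′} → a - b ≡ a′ - b → a ≡ a′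
    shift-injective {a} {a′} eq = trans (sym (//-rightDividesˡ b a)) (trans (cong (_+ b) eq) (//-rightDividesˡ b a′))

  nonzero-power : ∀ {c} → c ∈ A → c ≢ 0# → ∀ i → ∃ λ y → y ∈ P i × y ≢ 0#
  nonzero-power {c} c∈A c≢0 = prodPow-witness (_≢ 0#) c∈A (1#≢0# p-prime) λ {y} y≢0 yc≡0 →
    [ y≢0 , c≢0 ]′ (noZeroDivisors p-prime y c yc≡0)

  module _ (2≤∣A∣ : 2 ≤ ∣ A ∣) {b₁ b₂} (b₁∈A : b₁ ∈ A) (b₂∈A : b₂ ∈ A) (b₁≢b₂ : b₁ ≢ b₂) where

    nonzero-product : ∀ i → ∃ λ y → y ∈ P i × y ≢ 0#
    nonzero-product with b₁ ≟ 0#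
    ... | yes b₁≡0 = nonzero-power b₂∈A λ b₂≡0 → b₁≢b₂ (trans b₁≡0 (sym b₂≡0))
    ... | no b₁≢0  = nonzero-power b₁∈A b₁≢0

    growth : ∀ i → Large p (∣ A ∣ ^ suc i) ∣ S (suc i) ∣
    growth zero    = subst (λ K → Large p K ∣ S 1 ∣) (sym (ℕₚ.*-identityʳ ∣ A ∣))
                           (large-base p (∣ A ∣) (∣ S 1 ∣) (base b₁∈A))
    growth (suc i) with nonzero-product i
    ... | y , y∈P , y≢0 = subst (λ K → Large p K ∣ S (suc (suc i)) ∣) (ℕₚ.*-comm (∣ A ∣ ^ suc i) ∣ A ∣)
      (large-step p ∣ A ∣ (∣ A ∣ ^ suc i) (∣ S (suc i) ∣) (∣ S (suc (suc i)) ∣)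
                  2≤∣A∣ (ℕ.>-nonZero⁻¹ p) (ℕₚ.m^n>0 ∣ A ∣ (suc i)) (growth i) step)
      where
      instance _ = ℕ.>-nonZero (ℕₚ.<-trans (s≤s z≤n) 2≤∣A∣)
      step : p ℕ.* (∣ S (suc i) ∣ ℕ.* ∣ A ∣) ≤ ∣ S (suc (suc i)) ∣ ℕ.* (p ℕ.+ 2 ℕ.* (∣ S (suc i) ∣ ℕ.* ∣ A ∣))
      step = key-step (S (suc i)) A (S (suc (suc i))) y≢0 (sumset-G (suc i)) (sumset-H i y∈P)
                      (0∈S b₁∈A (suc i)) b₁∈A b₂∈A b₁≢b₂

  S-large : 2 ≤ ∣ A ∣ → ∀ i → Large p (∣ A ∣ ^ suc i) ∣ S (suc i) ∣
  S-large 2≤∣A∣ i with two-members A 2≤∣A∣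
  ... | b₁ , b₂ , b₁∈A , b₂∈A , b₁≢b₂ = growth 2≤∣A∣ b₁∈A b₂∈A b₁≢b₂ i

  main-bound : ∀ i → (∣ A ∣ ^ suc i) ⊓ p ≤ 8 ℕ.* ∣ S (suc i) ∣
  main-bound i with ∣ A ∣ in ∣A∣≡m
  ... | 0           = z≤n
  ... | 1           with some-member A (ℕₚ.≤-reflexive (sym ∣A∣≡m))
  ...   | a , a∈A   = begin
    (1 ^ suc i) ⊓ p       ≤⟨ ℕₚ.m⊓n≤m (1 ^ suc i) p ⟩
    1 ^ suc i             ≡⟨ ℕₚ.^-zeroˡ (suc i) ⟩
    1                     ≤⟨ ℕₚ.≤-trans (s≤s z≤n) (x∈p⇒∣p-x∣<∣p∣ (0∈S a∈A (suc i))) ⟩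
    ∣ S (suc i) ∣         ≤⟨ ℕₚ.m≤n*m ∣ S (suc i) ∣ 8 ⟩
    8 ℕ.* ∣ S (suc i) ∣   ∎
    where open ℕₚ.≤-Reasoning
  main-bound i | suc (suc _) = subst (λ m → (m ^ suc i) ⊓ p ≤ 8 ℕ.* ∣ S (suc i) ∣) ∣A∣≡m
    (large⇒bound p (∣ A ∣ ^ suc i) ∣ S (suc i) ∣ (ℕ.>-nonZero⁻¹ p)
      (S-large (subst (2 ≤_) (sym ∣A∣≡m) (s≤s (s≤s z≤n))) i))

open import Data.Nat using (_*_)

lemma2 : (p : ℕ) .{{_ : NonZero p}} → Prime p → (A : Subset p) → (n : ℕ) → 1 ≤ n →
    (∣ A ∣ ^ n) ⊓ p ≤ 8 * ∣ sumPow (8 ^ n) (prodPow n A) ⊖ sumPow (8 ^ n) (prodPow n A) ∣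
lemma2 p p-prime A (suc i) _ = Growth.main-bound p-prime A i
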